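{- Let $n$ and $l$ be positive integers. Then $n$ lions suffice to clear the graph $R_{n,l}$ of contamination: for every initial placement of $n$ lions on vertices of $R_{n,l}$ there is a sequence of (unrestricted) lion moves such that $C(t)=V(R_{n,l})$ at some time $t$.
   Context: For positive integers $n,l$, $R_{n,l}$ is the graph with vertex set $\{(i,j): 1\le i\le l,\ 1\le j\le n\}$ in which $(i,j)$ and $(i',j')$ are adjacent if and only if $(i'-i,j'-j)\in\{(\pm1,0),(0,\pm1),(1,-1),(-1,1)\}$ (a parallelogram-shaped piece of the triangular lattice with $n$ rows of $l$ vertices each). Lions and contamination model: lions occupy vertices of a graph $G=(V,E)$ (several lions may share a vertex). Time is discrete, $t=0,1,2,\dots$. Between times $t$ and $t+1$ each lion either stays at its vertex or moves along an edge to an adjacent vertex. $C(t)\subseteq V$ denotes the set of cleared vertices at time $t$. $C(0)$ is the set of vertices occupied by lions at time $0$. For $t\ge0$, a vertex $v$ lies in $C(t+1)$ if and only if either $v$ is occupied by a lion at time $t+1$, or $v\in C(t)$ and for every vertex $u$ adjacent to $v$ with $u\notin C(t)$, some lion moves across the edge from $v$ to $u$ between times $t$ and $t+1$. -}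

module Defs where

open import Data.Nat using (ℕ; zero; suc)
open import Data.Fin using (Fin; toℕ)
open import Data.Product using (_×_; Σ; ∃; _,_)
open import Data.Sum using (_⊎_)
open import Relation.Binary.PropositionalEquality using (_≡_)
open import Relation.Nullary using (¬_)

-- Vertices of R_{n,l}: pairs (i , j) with i ∈ {0..l-1}, j ∈ {0..n-1}
-- (0-based version of 1 ≤ i ≤ l, 1 ≤ j ≤ n).
Vertex : ℕ → ℕ → Set
Vertex n l = Fin l × Fin n

-- (i,j) ~ (i',j') iff (i'-i, j'-j) ∈ {(±1,0),(0,±1),(1,-1),(-1,1)}
Adj : ∀ {n l} → Vertex n l → Vertex n l → Set
Adj (i , j) (i' , j') =
     (suc (toℕ i) ≡ toℕ i' × toℕ j ≡ toℕ j')
  ⊎ (toℕ i ≡ suc (toℕ i') × toℕ j ≡ toℕ j')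
  ⊎ (toℕ i ≡ toℕ i' × suc (toℕ j) ≡ toℕ j')
  ⊎ (toℕ i ≡ toℕ i' × toℕ j ≡ suc (toℕ j'))
  ⊎ (suc (toℕ i) ≡ toℕ i' × toℕ j ≡ suc (toℕ j'))
  ⊎ (toℕ i ≡ suc (toℕ i') × suc (toℕ j) ≡ toℕ j')

Schedule : ℕ → ℕ → ℕ → Set
Schedule n l k = ℕ → Fin k → Vertex n l

ValidSchedule : ∀ {n l k} → Schedule n l k → Set
ValidSchedule {k = k} P =
  ∀ (t : ℕ) (a : Fin k) → P (suc t) a ≡ P t a ⊎ Adj (P t a) (P (suc t) a)

Occupied : ∀ {n l k} → Schedule n l k → ℕ → Vertex n l → Set
Occupied {k = k} P t v = Σ (Fin k) λ a → P t a ≡ v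

MovesAcross : ∀ {n l k} → Schedule n l k → ℕ → Vertex n l → Vertex n l → Set
MovesAcross {k = k} P t v u = Σ (Fin k) λ a → P t a ≡ v × P (suc t) a ≡ u

Cleared : ∀ {n l k} → Schedule n l k → ℕ → Vertex n l → Set
Cleared P zero v = Occupied P zero v
Cleared P (suc t) v =
  Occupied P (suc t) v
  ⊎ (Cleared P t v × (∀ u → Adj v u → ¬ Cleared P t u → MovesAcross P t v u))

-- Walk every lion to the left column, lion a ending in row a, so that the whole
-- column is occupied. Then sweep: the lions advance one column at a time, one
-- lion per step and in increasing row order. While lion j moves from (i , j)
-- to (i + 1 , j), the cleared region is every column up to i together with rows
-- below j of column i + 1. The neighbours of (i , y) in column i + 1 are
-- (i + 1 , y) and (i + 1 , y - 1), so the only uncleared neighbour of a vertex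
-- that is left unoccupied is the one lion j is stepping onto.
module Submission where

open import Defs
open import Data.Nat using (ℕ; _≤_; zero; suc; _+_; _*_; _∸_; _<_; pred; ∣_-_∣; z≤n; s≤s)
open import Data.Nat.Properties
open import Data.Nat.DivMod using (_%_; [m+kn]%n≡m%n; m<n⇒m%n≡m)
open import Data.Fin using (Fin; toℕ; zero; suc; inject₁; fromℕ)
open import Data.Fin.Properties using (toℕ-injective; toℕ-inject₁; toℕ<n; toℕ-fromℕ)
open import Data.Product using (Σ; _×_; _,_; proj₁; proj₂)
open import Data.Sum using (_⊎_; inj₁; inj₂)
open import Function using (_∘_)
open import Relation.Nullary using (¬_; yes; no; contradiction)
open import Relation.Binary using (tri<; tri≈; tri>)
open import Relation.Binary.PropositionalEquality
  using (_≡_; _≢_; refl; sym; trans; cong; subst; subst₂; module ≡-Reasoning)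

private
  variable
    n l k : ℕ

column : Vertex n l → ℕ
column v = toℕ (proj₁ v)

row : Vertex n l → ℕ
row v = toℕ (proj₂ v)

vertex-≡ : {v w : Vertex n l} → column v ≡ column w → row v ≡ row w → v ≡ w
vertex-≡ {v = _ , _} {_ , _} c r = subst₂ (λ x y → _ ≡ (x , y)) (toℕ-injective c) (toℕ-injective r) refl

StepOrStayℕ : ℕ → ℕ → Set
StepOrStayℕ m m′ = m′ ≡ m ⊎ m′ ≡ suc m ⊎ suc m′ ≡ m

StepOrStay : Vertex n l → Vertex n l → Set
StepOrStay v v′ = v′ ≡ v ⊎ Adj v v′

column-step : {x x′ : Fin l} {y : Fin n} →
              StepOrStayℕ (toℕ x) (toℕ x′) → StepOrStay (x , y) (x′ , y)
column-step {y = y} (inj₁ e)         = inj₁ (cong (_, y) (toℕ-injective e))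
column-step         (inj₂ (inj₁ e)) = inj₂ (inj₁ (sym e , refl))
column-step         (inj₂ (inj₂ e)) = inj₂ (inj₂ (inj₁ (sym e , refl)))

row-step : {x : Fin l} {y y′ : Fin n} →
           StepOrStayℕ (toℕ y) (toℕ y′) → StepOrStay (x , y) (x , y′)
row-step {x = x} (inj₁ e)         = inj₁ (cong (x ,_) (toℕ-injective e))
row-step         (inj₂ (inj₁ e)) = inj₂ (inj₂ (inj₂ (inj₁ (refl , sym e))))
row-step         (inj₂ (inj₂ e)) = inj₂ (inj₂ (inj₂ (inj₂ (inj₁ (refl , sym e)))))

stepTowards : ∀ {m} → Fin m → Fin m → Fin m
stepTowards zero          zero    = zero
stepTowards zero          (suc x) = inject₁ x
stepTowards (suc t)       (suc x) = suc (stepTowards t x)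
stepTowards (suc zero)    zero    = suc zero
stepTowards (suc (suc _)) zero    = suc zero

suc-StepOrStayℕ : ∀ {m m′} → StepOrStayℕ m m′ → StepOrStayℕ (suc m) (suc m′)
suc-StepOrStayℕ (inj₁ e)         = inj₁ (cong suc e)
suc-StepOrStayℕ (inj₂ (inj₁ e)) = inj₂ (inj₁ (cong suc e))
suc-StepOrStayℕ (inj₂ (inj₂ e)) = inj₂ (inj₂ (cong suc e))

stepTowards-stepOrStay : ∀ {m} (t x : Fin m) → StepOrStayℕ (toℕ x) (toℕ (stepTowards t x))
stepTowards-stepOrStay zero          zero    = inj₁ refl
stepTowards-stepOrStay zero          (suc x) = inj₂ (inj₂ (cong suc (toℕ-inject₁ x)))
stepTowards-stepOrStay (suc t)       (suc x) = suc-StepOrStayℕ (stepTowards-stepOrStay t x)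
stepTowards-stepOrStay (suc zero)    zero    = inj₂ (inj₁ refl)
stepTowards-stepOrStay (suc (suc _)) zero    = inj₂ (inj₁ refl)

stepTowards-distance : ∀ {m} (t x : Fin m) →
                       ∣ toℕ t - toℕ (stepTowards t x) ∣ ≡ pred ∣ toℕ t - toℕ x ∣
stepTowards-distance zero          zero    = refl
stepTowards-distance zero          (suc x) = toℕ-inject₁ x
stepTowards-distance (suc t)       (suc x) = stepTowards-distance t x
stepTowards-distance (suc zero)    zero    = refl
stepTowards-distance (suc (suc _)) zero    = refl

stepTowards-increasing : ∀ {m} (t x : Fin m) → toℕ x < toℕ t →
                         toℕ (stepTowards t x) ≡ suc (toℕ x)
stepTowards-increasing (suc zero)    zero    _         = refl
stepTowards-increasing (suc (suc _)) zero    _         = refl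
stepTowards-increasing (suc t)       (suc x) (s≤s x<t) = cong suc (stepTowards-increasing t x x<t)

Moves : ℕ → ℕ → ℕ → Set
Moves n l k = ℕ → Fin k → Vertex n l → Vertex n l

Legal : Moves n l k → Set
Legal {k = k} m = ∀ t (a : Fin k) v → StepOrStay v (m t a v)

run : (Fin k → Vertex n l) → Moves n l k → Schedule n l k
run s m zero    a = s a
run s m (suc t) a = m t a (run s m t a)

run-valid : {s : Fin k → Vertex n l} {m : Moves n l k} → Legal m → ValidSchedule (run s m)
run-valid {s = s} {m} legal t a = legal t a (run s m t a)

run-cong : {s s′ : Fin k → Vertex n l} (m : Moves n l k) →
           (∀ a → s a ≡ s′ a) → ∀ t a → run s m t a ≡ run s′ m t a
run-cong m s≡s′ zero    a = s≡s′ a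
run-cong m s≡s′ (suc t) a = cong (m t a) (run-cong m s≡s′ t a)

run-measure : {s : Fin k → Vertex n l} {m : Moves n l k} (d : Fin k → Vertex n l → ℕ) →
              (∀ t a v → d a (m t a v) ≡ pred (d a v)) →
              ∀ t a → d a (run s m t a) ≡ d a (s a) ∸ t
run-measure d decrease zero    a = refl
run-measure {s = s} {m} d decrease (suc t) a = begin
  d a (m t a (run s m t a)) ≡⟨ decrease t a (run s m t a) ⟩
  pred (d a (run s m t a))  ≡⟨ cong pred (run-measure d decrease t a) ⟩
  pred (d a (s a) ∸ t)      ≡⟨ pred[m∸n]≡m∸[1+n] (d a (s a)) t ⟩
  d a (s a) ∸ suc t         ∎
  where open ≡-Reasoning

phases : ℕ → Moves n l k → Moves n l k → Moves n l k
phases d m₁ m₂ t with t <? d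
... | yes _ = m₁ t
... | no  _ = m₂ (t ∸ d)

module _ {m₁ m₂ : Moves n l k} (d : ℕ) where

  phases-first : ∀ {t} → t < d → phases d m₁ m₂ t ≡ m₁ t
  phases-first {t} t<d with t <? d
  ... | yes _   = refl
  ... | no  t≮d = contradiction t<d t≮d

  phases-second : ∀ t → phases d m₁ m₂ (d + t) ≡ m₂ t
  phases-second t with d + t <? d
  ... | yes d+t<d = contradiction d+t<d (m+n≮m d t)
  ... | no  _     = cong m₂ (m+n∸m≡n d t)

  phases-legal : Legal m₁ → Legal m₂ → Legal (phases d m₁ m₂)
  phases-legal legal₁ legal₂ t with t <? d
  ... | yes _ = legal₁ t
  ... | no  _ = legal₂ (t ∸ d)

  run-phases-prefix : (s : Fin k → Vertex n l) → ∀ t → t ≤ d → ∀ a →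
                      run s (phases d m₁ m₂) t a ≡ run s m₁ t a
  run-phases-prefix s zero    _   a = refl
  run-phases-prefix s (suc t) t<d a rewrite phases-first t<d =
    cong (m₁ t a) (run-phases-prefix s t (<⇒≤ t<d) a)

  run-phases-suffix : (s : Fin k → Vertex n l) → ∀ t a →
                      run s (phases d m₁ m₂) (d + t) a ≡ run (run s m₁ d) m₂ t a
  run-phases-suffix s zero a rewrite +-identityʳ d = run-phases-prefix s d ≤-refl a
  run-phases-suffix s (suc t) a rewrite +-suc d t | phases-second t =
    cong (m₂ t a) (run-phases-suffix s t a)

ClearedOn : Schedule n l k → ℕ → (Vertex n l → Set) → Set
ClearedOn P t R = ∀ v → R v → Cleared P t v

occupied⇒cleared : {P : Schedule n l k} {v : Vertex n l} → ∀ t → Occupied P t v → Cleared P t v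
occupied⇒cleared zero    o = o
occupied⇒cleared (suc t) o = inj₁ o

guarded⇒cleared : {P : Schedule n l k} {t : ℕ} {R : Vertex n l → Set} {v : Vertex n l} →
                  ClearedOn P t R → Cleared P t v →
                  (∀ u → Adj v u → R u ⊎ MovesAcross P t v u) → Cleared P (suc t) v
guarded⇒cleared {P = P} {t} {v = v} clr c guard = inj₂ (c , crossed)
  where
    crossed : ∀ u → Adj v u → ¬ Cleared P t u → MovesAcross P t v u
    crossed u adj u∉C with guard u adj
    ... | inj₁ r    = contradiction (clr u r) u∉C
    ... | inj₂ move = move

-- The suffix starts from the occupied vertices only, a subset of C(d), and
-- clearing is monotone in the starting set.
cleared-suffix : {P Q : Schedule n l k} (d : ℕ) → (∀ t a → Q t a ≡ P (d + t) a) →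
                 ∀ t v → Cleared Q t v → Cleared P (d + t) v
cleared-suffix d Q≡P zero v (a , e) =
  occupied⇒cleared (d + zero) (a , trans (sym (Q≡P zero a)) e)
cleared-suffix {P = P} {Q} d Q≡P (suc t) v c =
  subst (λ τ → Cleared P τ v) (sym (+-suc d t)) (shift c)
  where
    Q≡P′ : ∀ a → Q (suc t) a ≡ P (suc (d + t)) a
    Q≡P′ a = trans (Q≡P (suc t) a) (cong (λ τ → P τ a) (+-suc d t))

    shift-move : ∀ {u} → MovesAcross Q t v u → MovesAcross P (d + t) v u
    shift-move (a , from , to) = a , trans (sym (Q≡P t a)) from , trans (sym (Q≡P′ a)) to

    shift : Cleared Q (suc t) v → Cleared P (suc (d + t)) v
    shift (inj₁ (a , e))    = inj₁ (a , trans (sym (Q≡P′ a)) e)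
    shift (inj₂ (c , safe)) = inj₂ (cleared-suffix d Q≡P t v c ,
      λ u adj u∉C → shift-move (safe u adj (u∉C ∘ cleared-suffix d Q≡P t u)))

-- The region swept when lion j of column i is about to move.

Swept : ℕ → ℕ → Vertex n l → Set
Swept i j v = column v ≤ i ⊎ (column v ≡ suc i × row v < j)

adj-Swept : {v u : Vertex n l} → Adj v u → Swept (column v) (suc (row v)) u
adj-Swept (inj₁ (e , f))                              = inj₂ (sym e , ≤-reflexive (cong suc (sym f)))
adj-Swept (inj₂ (inj₁ (e , _)))                       = inj₁ (≤-trans (n≤1+n _) (≤-reflexive (sym e)))
adj-Swept (inj₂ (inj₂ (inj₁ (e , _))))                = inj₁ (≤-reflexive (sym e))
adj-Swept (inj₂ (inj₂ (inj₂ (inj₁ (e , _)))))         = inj₁ (≤-reflexive (sym e))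
adj-Swept (inj₂ (inj₂ (inj₂ (inj₂ (inj₁ (e , f))))))  = inj₂ (sym e , ≤-trans (n≤1+n _) (≤-reflexive (cong suc (sym f))))
adj-Swept (inj₂ (inj₂ (inj₂ (inj₂ (inj₂ (e , _))))))  = inj₁ (≤-trans (n≤1+n _) (≤-reflexive (sym e)))

Swept-mono-column : ∀ {i i′ j j′} {v : Vertex n l} → i < i′ → Swept i j v → Swept i′ j′ v
Swept-mono-column i<i′ (inj₁ c≤i)         = inj₁ (≤-trans c≤i (<⇒≤ i<i′))
Swept-mono-column i<i′ (inj₂ (c≡1+i , _)) = inj₁ (subst (_≤ _) (sym c≡1+i) i<i′)

Swept-mono-row : ∀ {i j j′} {v : Vertex n l} → j ≤ j′ → Swept i j v → Swept i j′ v
Swept-mono-row j≤j′ (inj₁ c≤i)           = inj₁ c≤i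
Swept-mono-row j≤j′ (inj₂ (c≡1+i , r<j)) = inj₂ (c≡1+i , ≤-trans r<j j≤j′)

Swept-suc-row : ∀ {i j} {v : Vertex n l} → Swept i (suc j) v →
                Swept i j v ⊎ (column v ≡ suc i × row v ≡ j)
Swept-suc-row (inj₁ c≤i) = inj₁ (inj₁ c≤i)
Swept-suc-row (inj₂ (c≡1+i , s≤s r≤j)) with m≤n⇒m<n∨m≡n r≤j
... | inj₁ r<j = inj₁ (inj₂ (c≡1+i , r<j))
... | inj₂ r≡j = inj₂ (c≡1+i , r≡j)

Swept-suc-column : ∀ {i} {v : Vertex n l} → Swept (suc i) 0 v → Swept i n v
Swept-suc-column {v = _ , y} (inj₁ c≤1+i) with m≤n⇒m<n∨m≡n c≤1+i
... | inj₁ c<1+i = inj₁ (≤-pred c<1+i)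
... | inj₂ c≡1+i = inj₂ (c≡1+i , toℕ<n y)

module Clearing (n′ l′ : ℕ) where

  N : ℕ
  N = suc n′

  V : Set
  V = Vertex N (suc l′)

  G : ℕ
  G = l′ + n′

  gatherMove : Fin N → V → V
  gatherMove a (zero  , y) = zero , stepTowards a y
  gatherMove a (suc x , y) = inject₁ x , y

  gatherMove-legal : ∀ a (v : V) → StepOrStay v (gatherMove a v)
  gatherMove-legal a (zero  , y) = row-step (stepTowards-stepOrStay a y)
  gatherMove-legal a (suc x , y) = column-step (inj₂ (inj₂ (cong suc (toℕ-inject₁ x))))

  -- The distance to (0 , a) along a path that first walks left, then along column 0.
  gatherMeasure : Fin N → V → ℕ
  gatherMeasure a v = column v + ∣ toℕ a - row v ∣

  gatherMeasure-decreasing : ∀ a v → gatherMeasure a (gatherMove a v) ≡ pred (gatherMeasure a v)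
  gatherMeasure-decreasing a (zero  , y) = stepTowards-distance a y
  gatherMeasure-decreasing a (suc x , y) = cong (_+ ∣ toℕ a - toℕ y ∣) (toℕ-inject₁ x)

  gatherMeasure-bounded : ∀ a v → gatherMeasure a v ≤ G
  gatherMeasure-bounded a (x , y) =
    +-mono-≤ (≤-pred (toℕ<n x))
             (≤-trans (∣m-n∣≤m⊔n (toℕ a) (toℕ y)) (⊔-lub (≤-pred (toℕ<n a)) (≤-pred (toℕ<n y))))

  gatherMeasure-zero : ∀ a v → gatherMeasure a v ≡ 0 → v ≡ (zero , a)
  gatherMeasure-zero a v m≡0 =
    vertex-≡ (m+n≡0⇒m≡0 (column v) m≡0) (sym (∣m-n∣≡0⇒m≡n (m+n≡0⇒n≡0 (column v) m≡0)))

  gathered : (start : Fin N → V) → ∀ a → run start (λ _ → gatherMove) G a ≡ (zero , a)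
  gathered start a = gatherMeasure-zero a _ (begin
    gatherMeasure a (run start (λ _ → gatherMove) G a)
      ≡⟨ run-measure gatherMeasure (λ _ → gatherMeasure-decreasing) G a ⟩
    gatherMeasure a (start a) ∸ G
      ≡⟨ m≤n⇒m∸n≡0 (gatherMeasure-bounded a (start a)) ⟩
    0 ∎)
    where open ≡-Reasoning

  sweepMove : ℕ → Fin N → V → V
  sweepMove s a (x , y) with s % N ≟ toℕ a
  ... | yes _ = stepTowards (fromℕ l′) x , y
  ... | no  _ = x , y

  sweepMove-legal : Legal sweepMove
  sweepMove-legal s a (x , y) with s % N ≟ toℕ a
  ... | yes _ = column-step (stepTowards-stepOrStay (fromℕ l′) x)
  ... | no  _ = inj₁ refl

  sweepMove-row : ∀ s a (v : V) → proj₂ (sweepMove s a v) ≡ proj₂ v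
  sweepMove-row s a (x , y) with s % N ≟ toℕ a
  ... | yes _ = refl
  ... | no  _ = refl

  sweepMove-mover : ∀ s a (v : V) → s % N ≡ toℕ a → column v < l′ →
                    column (sweepMove s a v) ≡ suc (column v)
  sweepMove-mover s a (x , y) s≡a c<l′ with s % N ≟ toℕ a
  ... | yes _   = stepTowards-increasing (fromℕ l′) x (subst (toℕ x <_) (sym (toℕ-fromℕ l′)) c<l′)
  ... | no  s≢a = contradiction s≡a s≢a

  sweepMove-idle : ∀ s a (v : V) → s % N ≢ toℕ a → sweepMove s a v ≡ v
  sweepMove-idle s a (x , y) s≢a with s % N ≟ toℕ a
  ... | yes s≡a = contradiction s≡a s≢a
  ... | no  _   = refl

  sweep : Schedule N (suc l′) N
  sweep = run (λ a → zero , a) sweepMove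

  sweep-row : ∀ s a → row (sweep s a) ≡ toℕ a
  sweep-row zero    a = refl
  sweep-row (suc s) a = trans (cong toℕ (sweepMove-row s a (sweep s a))) (sweep-row s a)

  LionsAt : ℕ → ℕ → ℕ → Set
  LionsAt i j s = ∀ a → (toℕ a < j → column (sweep s a) ≡ suc i) × (j ≤ toℕ a → column (sweep s a) ≡ i)

  located : ∀ {i j} s → LionsAt i j s → ∀ {a} {v : V} → toℕ a ≡ row v →
            (toℕ a < j × column v ≡ suc i) ⊎ (j ≤ toℕ a × column v ≡ i) → sweep s a ≡ v
  located s lions {a} a≡r (inj₁ (a<j , c)) =
    vertex-≡ (trans (proj₁ (lions a) a<j) (sym c)) (trans (sweep-row s a) a≡r)
  located s lions {a} a≡r (inj₂ (j≤a , c)) =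
    vertex-≡ (trans (proj₂ (lions a) j≤a) (sym c)) (trans (sweep-row s a) a≡r)

  lionsAt-step : ∀ {i j s} → i < l′ → s % N ≡ j → LionsAt i j s → LionsAt i (suc j) (suc s)
  lionsAt-step {i} {j} {s} i<l′ s≡j lions a with toℕ a ≟ j
  ... | yes a≡j = (λ _ → moved) , (λ j<a → contradiction (sym a≡j) (<⇒≢ j<a))
    where
      before : column (sweep s a) ≡ i
      before = proj₂ (lions a) (≤-reflexive (sym a≡j))

      moved : column (sweep (suc s) a) ≡ suc i
      moved = trans (sweepMove-mover s a (sweep s a) (trans s≡j (sym a≡j)) (subst (_< l′) (sym before) i<l′))
                    (cong suc before)
  ... | no a≢j =
    (λ a<1+j → trans idle (proj₁ (lions a) (≤∧≢⇒< (≤-pred a<1+j) a≢j))) ,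
    (λ j<a → trans idle (proj₂ (lions a) (<⇒≤ j<a)))
    where
      idle : column (sweep (suc s) a) ≡ column (sweep s a)
      idle = cong column (sweepMove-idle s a (sweep s a) (λ s≡a → a≢j (trans (sym s≡a) s≡j)))

  clearedOn-step : ∀ {i j s} → LionsAt i j s → LionsAt i (suc j) (suc s) →
                   ClearedOn sweep s (Swept i j) → ClearedOn sweep (suc s) (Swept i (suc j))
  clearedOn-step {i} {j} {s} lions lions′ clr (_ , y) (inj₂ (c≡1+i , y<1+j)) =
    occupied⇒cleared (suc s) (y , located (suc s) lions′ refl (inj₁ (y<1+j , c≡1+i)))
  clearedOn-step {i} {j} {s} lions lions′ clr v@(_ , y) (inj₁ c≤i) with m≤n⇒m<n∨m≡n c≤i
  ... | inj₁ c<i = guarded⇒cleared clr (clr v (inj₁ c≤i))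
                     (λ u adj → inj₁ (Swept-mono-column c<i (adj-Swept adj)))
  ... | inj₂ c≡i with <-cmp (toℕ y) j
  ...   | tri< y<j _ _ = guarded⇒cleared clr (clr v (inj₁ c≤i))
                           (λ u adj → inj₁ (Swept-mono-row y<j (subst (λ c → Swept c _ u) c≡i (adj-Swept adj))))
  ...   | tri> _ _ j<y = occupied⇒cleared (suc s) (y , located (suc s) lions′ refl (inj₂ (j<y , c≡i)))
  ...   | tri≈ _ y≡j _ = guarded⇒cleared clr (clr v (inj₁ c≤i)) guard
    where
      guard : ∀ u → Adj v u → Swept i j u ⊎ MovesAcross sweep s v u
      guard u adj with Swept-suc-row (subst₂ (λ c r → Swept c (suc r) u) c≡i y≡j (adj-Swept adj))
      ... | inj₁ swept           = inj₁ swept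
      ... | inj₂ (c′≡1+i , r′≡j) =
        inj₂ (y , located s lions refl (inj₂ (≤-reflexive (sym y≡j) , c≡i)) ,
                  located (suc s) lions′ (trans y≡j (sym r′≡j)) (inj₁ (s≤s (≤-reflexive y≡j) , c′≡1+i)))

  Invariant : ℕ → ℕ → Set
  Invariant i j = LionsAt i j (j + i * N) × ClearedOn sweep (j + i * N) (Swept i j)

  invariant-initial : Invariant 0 0
  invariant-initial = lions , cleared
    where
      lions : LionsAt 0 0 0
      lions a = (λ ()) , (λ _ → refl)

      cleared : ClearedOn sweep 0 (Swept 0 0)
      cleared (_ , y) (inj₁ c≤0)   = y , located 0 lions refl (inj₂ (z≤n , n≤0⇒n≡0 c≤0))
      cleared _       (inj₂ (_ , ()))

  invariant-step : ∀ {i j} → i < l′ → j < N → Invariant i j → Invariant i (suc j)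
  invariant-step {i} {j} i<l′ j<N (lions , clr) = lions′ , clearedOn-step lions lions′ clr
    where
      lions′ : LionsAt i (suc j) (suc (j + i * N))
      lions′ = lionsAt-step {s = j + i * N} i<l′ (trans ([m+kn]%n≡m%n j i N) (m<n⇒m%n≡m j<N)) lions

  invariant-nextColumn : ∀ {i} → Invariant i N → Invariant (suc i) 0
  invariant-nextColumn (lions , clr) =
    (λ a → (λ ()) , (λ _ → proj₁ (lions a) (toℕ<n a))) , (λ v → clr v ∘ Swept-suc-column)

  invariant-column : ∀ {i} → i < l′ → Invariant i 0 → ∀ j → j ≤ N → Invariant i j
  invariant-column i<l′ inv zero    _     = inv
  invariant-column i<l′ inv (suc j) j<N = invariant-step i<l′ j<N (invariant-column i<l′ inv j (<⇒≤ j<N))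

  invariant : ∀ i → i ≤ l′ → Invariant i 0
  invariant zero    _      = invariant-initial
  invariant (suc i) i<l′ =
    invariant-nextColumn (invariant-column i<l′ (invariant i (<⇒≤ i<l′)) N ≤-refl)

  sweep-clears : ∀ v → Cleared sweep (l′ * N) v
  sweep-clears v = proj₂ (invariant l′ ≤-refl) v (inj₁ (≤-pred (toℕ<n (proj₁ v))))

  schedule : (Fin N → V) → Schedule N (suc l′) N
  schedule start = run start (phases G (λ _ → gatherMove) sweepMove)

  schedule-valid : (start : Fin N → V) → ValidSchedule (schedule start)
  schedule-valid start = run-valid (phases-legal G (λ _ → gatherMove-legal) sweepMove-legal)

  schedule-sweeps : (start : Fin N → V) → ∀ s a → sweep s a ≡ schedule start (G + s) a
  schedule-sweeps start s a = sym (trans (run-phases-suffix G start s a)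
                                         (run-cong sweepMove (gathered start) s a))

mainTheorem5 : (n l : ℕ) → 1 ≤ n → 1 ≤ l →
    (start : Fin n → Vertex n l) →
    Σ (Schedule n l n) λ P →
      ((∀ a → P 0 a ≡ start a) × ValidSchedule P) × Σ ℕ λ t → ∀ v → Cleared P t v
mainTheorem5 (suc n′) (suc l′) _ _ start =
  schedule start , ((λ _ → refl) , schedule-valid start) ,
  G + l′ * N , λ v → cleared-suffix G (schedule-sweeps start) (l′ * N) v (sweep-clears v)
  where open Clearing n′ l′
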